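{- Let $V$ be a finite set, $d$ a nonnegative integer, and $f:2^V\to\{0,1,\dots,d\}$ a posimodular function. Let $S$ be a maximal maximizer of $f$. Then $f(X\cup\{v\})\ge f(X)+1$ for every subset $X\subseteq V$ and every element $v\in V$ such that $X$, $\{v\}$ and $S$ are pairwise disjoint.
   Context: A set function $f:2^V\to\mathbb{R}$ is posimodular if $f(X)+f(Y)\ge f(X\setminus Y)+f(Y\setminus X)$ for all $X,Y\subseteq V$. A maximizer of $f$ is a subset $S\subseteq V$ with $f(S)=\max\{f(X)\mid X\subseteq V\}$; it is a maximal maximizer if no proper superset of $S$ is a maximizer of $f$. -}

module Defs where

open import Data.Nat using (ℕ; _+_; _≤_)
open import Data.Fin.Subset using (Subset; _─_; _⊂_)
open import Relation.Nullary using (¬_)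

Posimodular : ∀ {n} → (Subset n → ℕ) → Set
Posimodular f = ∀ X Y → f (X ─ Y) + f (Y ─ X) ≤ f X + f Y

IsMaximizer : ∀ {n} → (Subset n → ℕ) → Subset n → Set
IsMaximizer f S = ∀ X → f X ≤ f S

IsMaximalMaximizer : ∀ {n} → (Subset n → ℕ) → Subset n → Set
IsMaximalMaximizer f S = IsMaximizer f S × (∀ T → S ⊂ T → ¬ IsMaximizer f T)
  where open import Data.Product using (_×_)

-- Apply posimodularity to X ∪ {v} and S ∪ {v}: by the disjointness assumptions the two
-- differences are exactly X and S, so f(X) + f(S) ≤ f(X ∪ {v}) + f(S ∪ {v}). Since S is a
-- maximal maximizer and S ∪ {v} is a proper superset, f(S ∪ {v}) < f(S), whence
-- f(X) < f(X ∪ {v}).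
module Submission where

open import Defs
open import Data.Nat using (ℕ; suc; _≤_; _<_; _+_)
open import Data.Nat.Properties using (≤-trans; ≰⇒>; ≤-<-trans; +-monoʳ-<; +-cancelʳ-<; module ≤-Reasoning)
open import Data.Fin using (Fin; zero)
open import Data.Fin.Subset using (Subset; _∪_; _∩_; ⁅_⁆; _∈_; _∉_; _─_; _⊂_; Empty; inside; outside)
open import Data.Fin.Subset.Properties
  using (drop-∷-Empty; x∈p∩q⁻; x∈⁅x⁆; x∈⁅y⁆⇒x≡y; p⊆p∪q; q⊆p∪q; ∩-comm; ∪-comm; p─q─r≡p─q∪r)
open import Data.Vec using ([]; _∷_; here)
open import Data.Product using (_,_)
open import Relation.Nullary using (contradiction)
open import Relation.Binary.PropositionalEquality using (_≡_; refl; sym; cong; cong₂; subst; module ≡-Reasoning)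

Empty-∩-comm : ∀ {n} (p q : Subset n) → Empty (p ∩ q) → Empty (q ∩ p)
Empty-∩-comm p q = subst Empty (∩-comm p q)

x∉p⇒Empty[p∩⁅x⁆] : ∀ {n} {x : Fin n} {p : Subset n} → x ∉ p → Empty (p ∩ ⁅ x ⁆)
x∉p⇒Empty[p∩⁅x⁆] {x = x} {p} x∉p (y , y∈p∩⁅x⁆) with x∈p∩q⁻ p ⁅ x ⁆ y∈p∩⁅x⁆
... | y∈p , y∈⁅x⁆ = x∉p (subst (_∈ p) (x∈⁅y⁆⇒x≡y x y∈⁅x⁆) y∈p)

x∉p⇒p⊂p∪⁅x⁆ : ∀ {n} {x : Fin n} {p : Subset n} → x ∉ p → p ⊂ p ∪ ⁅ x ⁆
x∉p⇒p⊂p∪⁅x⁆ {x = x} {p} x∉p = p⊆p∪q ⁅ x ⁆ , x , q⊆p∪q p ⁅ x ⁆ (x∈⁅x⁆ x) , x∉p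

p∪q─q≡p─q : ∀ {n} (p q : Subset n) → (p ∪ q) ─ q ≡ p ─ q
p∪q─q≡p─q []            []            = refl
p∪q─q≡p─q (s       ∷ p) (inside  ∷ q) = cong (outside ∷_) (p∪q─q≡p─q p q)
p∪q─q≡p─q (inside  ∷ p) (outside ∷ q) = cong (inside ∷_) (p∪q─q≡p─q p q)
p∪q─q≡p─q (outside ∷ p) (outside ∷ q) = cong (outside ∷_) (p∪q─q≡p─q p q)

Empty[p∩q]⇒p─q≡p : ∀ {n} (p q : Subset n) → Empty (p ∩ q) → p ─ q ≡ p
Empty[p∩q]⇒p─q≡p []            []            _ = refl
Empty[p∩q]⇒p─q≡p (s       ∷ p) (outside ∷ q) e = cong (s ∷_) (Empty[p∩q]⇒p─q≡p p q (drop-∷-Empty e))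
Empty[p∩q]⇒p─q≡p (outside ∷ p) (inside  ∷ q) e = cong (outside ∷_) (Empty[p∩q]⇒p─q≡p p q (drop-∷-Empty e))
Empty[p∩q]⇒p─q≡p (inside  ∷ p) (inside  ∷ q) e = contradiction (zero , here) e

p∪r─q∪r≡p : ∀ {n} (p q r : Subset n) → Empty (p ∩ q) → Empty (p ∩ r) → (p ∪ r) ─ (q ∪ r) ≡ p
p∪r─q∪r≡p p q r p∩q=∅ p∩r=∅ = begin
  (p ∪ r) ─ (q ∪ r)  ≡⟨ cong ((p ∪ r) ─_) (∪-comm q r) ⟩
  (p ∪ r) ─ (r ∪ q)  ≡⟨ sym (p─q─r≡p─q∪r (p ∪ r) r q) ⟩
  (p ∪ r) ─ r ─ q    ≡⟨ cong (_─ q) (p∪q─q≡p─q p r) ⟩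
  p ─ r ─ q          ≡⟨ cong (_─ q) (Empty[p∩q]⇒p─q≡p p r p∩r=∅) ⟩
  p ─ q              ≡⟨ Empty[p∩q]⇒p─q≡p p q p∩q=∅ ⟩
  p                  ∎
  where open ≡-Reasoning

posimodular-∪ : ∀ {n} (f : Subset n → ℕ) → Posimodular f → (A B T : Subset n) →
                Empty (A ∩ B) → Empty (A ∩ T) → Empty (B ∩ T) →
                f A + f B ≤ f (A ∪ T) + f (B ∪ T)
posimodular-∪ f posimodular A B T A∩B=∅ A∩T=∅ B∩T=∅ = begin
  f A + f B                                      ≡⟨ sym (cong₂ _+_ (cong f A-diff) (cong f B-diff)) ⟩
  f ((A ∪ T) ─ (B ∪ T)) + f ((B ∪ T) ─ (A ∪ T))  ≤⟨ posimodular (A ∪ T) (B ∪ T) ⟩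
  f (A ∪ T) + f (B ∪ T)                          ∎
  where
  open ≤-Reasoning
  A-diff : (A ∪ T) ─ (B ∪ T) ≡ A
  A-diff = p∪r─q∪r≡p A B T A∩B=∅ A∩T=∅
  B-diff : (B ∪ T) ─ (A ∪ T) ≡ B
  B-diff = p∪r─q∪r≡p B A T (Empty-∩-comm A B A∩B=∅) B∩T=∅

maximalMaximizer-⊂⇒> : ∀ {n} {f : Subset n → ℕ} {S T : Subset n} →
                        IsMaximalMaximizer f S → S ⊂ T → f T < f S
maximalMaximizer-⊂⇒> {T = T} (isMax , noLargerMax) S⊂T =
  ≰⇒> (λ fS≤fT → noLargerMax T S⊂T (λ X → ≤-trans (isMax X) fS≤fT))

lemma14 : (n d : ℕ) (f : Subset n → ℕ) → (∀ X → f X ≤ d) → Posimodular f →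
          (S : Subset n) → IsMaximalMaximizer f S →
          (X : Subset n) (v : Fin n) → Empty (X ∩ S) → v ∉ X → v ∉ S →
          suc (f X) ≤ f (X ∪ ⁅ v ⁆)
lemma14 n d f _ posimodular S maximal X v X∩S=∅ v∉X v∉S =
  +-cancelʳ-< (f S) (f X) (f (X ∪ ⁅ v ⁆)) (≤-<-trans exchange (+-monoʳ-< (f (X ∪ ⁅ v ⁆)) S∪v-smaller))
  where
  exchange : f X + f S ≤ f (X ∪ ⁅ v ⁆) + f (S ∪ ⁅ v ⁆)
  exchange = posimodular-∪ f posimodular X S ⁅ v ⁆ X∩S=∅ (x∉p⇒Empty[p∩⁅x⁆] v∉X) (x∉p⇒Empty[p∩⁅x⁆] v∉S)
  S∪v-smaller : f (S ∪ ⁅ v ⁆) < f S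
  S∪v-smaller = maximalMaximizer-⊂⇒> maximal (x∉p⇒p⊂p∪⁅x⁆ v∉S)
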